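{- Let $\mathfrak{D}'$ be a class of finite digraphs and $R\in\mathfrak{D}'$ with $\mathfrak{G}_{\mathfrak{D}'}(R)\subseteq\mathfrak{D}'$, where $\mathfrak{G}_{\mathfrak{D}'}(R)=\{\mathcal{G}(\xi): \xi\in\mathcal{H}(G,R), G\in\mathfrak{D}'\}$. Then for every finite digraph $S$, $R\sqsubseteq_\Gamma S$ with respect to $\mathfrak{D}'$ holds if and only if for every $\mathfrak{g}\in\mathfrak{G}_{\mathfrak{D}'}(R)$ there is an injective map $\sigma_{\mathfrak{g}}:\mathcal{S}(\mathfrak{g},R)\to\mathcal{S}(\mathfrak{g},S)$. In this case, setting $\rho_G(\xi)=\sigma_{\mathcal{G}(\xi)}(\iota_\xi)\circ\pi_\xi$ for every $G\in\mathfrak{D}'_r$ and $\xi\in\mathcal{H}(G,R)$ defines a strong $\Gamma$-scheme $\rho$ from $R$ to $S$ with respect to $\mathfrak{D}'$. The corresponding statements hold for $\mathfrak{D}'\subseteq\mathfrak{P}$ and for $\mathfrak{D}'\subseteq\mathfrak{P}^*$ when every element $\mathcal{G}(\xi)$ of $\mathfrak{G}_{\mathfrak{D}'}(R)$ is replaced by its transitive hull $\mathcal{T}(\xi)$ (both in the hypothesis and in the existence of the injections), and $\mathcal{G}(\xi)$ in the formula for $\rho_G(\xi)$ is replaced by $\mathcal{T}(\xi)$.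
   Context: A digraph $G=(V(G),A(G))$ has finite non-empty $V(G)$ and $A(G)\subseteq V(G)\times V(G)$; loops are arcs $vv$, proper arcs $vw$ with $v\ne w$; $G^*$ is $G$ without loops. $\mathcal{H}(G,H)$: homomorphisms (maps with $\xi(v)\xi(w)\in A(H)$ for $vw\in A(G)$); $\mathcal{S}(G,H)$: strict homomorphisms (proper arcs mapped to proper arcs). $v,w$ adjacent if $vw$ or $wv$ is an arc. For $X\subseteq V(G)$, $v\in X$, $\gamma_X(v)$ = set of $w\in X$ equal to $v$ or joined to $v$ by a sequence in $X$ of consecutively adjacent vertices; $\Gamma_\xi(v)=\gamma_{\xi^{ -1}(\xi(v))}(v)$. For $\xi\in\mathcal{H}(G,H)$, $\mathcal{G}(\xi)$ has vertex set $\{\Gamma_\xi(v): v\in V(G)\}$ and arcs $(\mathfrak{a},\mathfrak{b})$ whenever some $a\in\mathfrak{a}$, $b\in\mathfrak{b}$ satisfy $ab\in A(G)$; $\pi_\xi:V(G)\to V(\mathcal{G}(\xi))$, $v\mapsto\Gamma_\xi(v)$, and $\iota_\xi:V(\mathcal{G}(\xi))\to V(H)$, $\Gamma_\xi(v)\mapsto\xi(v)$. $\mathcal{T}(\xi)$ is the transitive hull of $\mathcal{G}(\xi)$ (same vertices, smallest transitive arc set containing the arcs). $\mathfrak{P}$ = finite posets, $\mathfrak{P}^*=\{P^*:P\in\mathfrak{P}\}$. $\mathfrak{D}'_r$ is a representative system of $\mathfrak{D}'$ up to isomorphism. A Hom-scheme from $R$ to $S$ w.r.t. $\mathfrak{D}'$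 is a family of maps $\rho_G:\mathcal{H}(G,R)\to\mathcal{H}(G,S)$, $G\in\mathfrak{D}'_r$; strong if all $\rho_G$ are injective; a $\Gamma$-scheme if $\Gamma_{\rho_G(\xi)}(v)=\Gamma_\xi(v)$ for all $G,\xi,v$. $R\sqsubseteq_\Gamma S$ w.r.t. $\mathfrak{D}'$ iff a strong $\Gamma$-scheme exists. -}

module Defs where

open import Data.Nat using (ℕ; zero; suc; _∸_; _+_)
open import Data.Fin using (Fin; zero; suc)
open import Data.Fin.Properties using (_≟_; _<?_)
open import Data.Bool using (Bool; true; false; _∧_; _∨_; not; T; if_then_else_)
open import Data.Vec using (Vec; lookup; tabulate)
open import Data.Product using (Σ; _×_; _,_; proj₁; proj₂)
open import Relation.Binary.PropositionalEquality using (_≡_; _≢_; _≗_; refl)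
open import Relation.Nullary using (does)

-- A digraph has vertex set Fin (suc m) (finite, non-empty)
-- and its arc set is given by a Boolean adjacency matrix (entry v w = true
-- iff vw is an arc).  Using a Vec-matrix makes equality of digraphs
-- concrete (no function extensionality needed).

Mat : ℕ → Set
Mat m = Vec (Vec Bool (suc m)) (suc m)

record Digraph : Set where
  constructor mkD
  field
    m   : ℕ
    adj : Mat m

V : Digraph → Set
V G = Fin (suc (Digraph.m G))

adjB : (G : Digraph) → V G → V G → Bool
adjB G v w = lookup (lookup (Digraph.adj G) v) w

Arc : (G : Digraph) → V G → V G → Set
Arc G v w = T (adjB G v w)

anyF : ∀ {n} → (Fin n → Bool) → Bool
anyF {zero}  f = false
anyF {suc n} f = f zero ∨ anyF (λ i → f (suc i))

countF : ∀ {n} → (Fin n → Bool) → ℕ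
countF {zero}  f = 0
countF {suc n} f = (if f zero then 1 else 0) + countF (λ i → f (suc i))

eqF : ∀ {n} → Fin n → Fin n → Bool
eqF i j = does (i ≟ j)

ltF : ∀ {n} → Fin n → Fin n → Bool
ltF i j = does (i <? j)

-- least index satisfying f (zero if there is none)
firstF : ∀ {n} → (Fin (suc n) → Bool) → Fin (suc n)
firstF {zero}  f = zero
firstF {suc n} f = if f zero then zero else suc (firstF (λ i → f (suc i)))

-- ℕ → Fin (suc k), identity on values ≤ k (clamped above)
clamp : (k : ℕ) → ℕ → Fin (suc k)
clamp zero    _       = zero
clamp (suc k) zero    = zero
clamp (suc k) (suc j) = suc (clamp k j)

iter : {A : Set} → ℕ → (A → A) → A → A
iter zero    f a = a
iter (suc n) f a = f (iter n f a)

stepR : ∀ {n} → (Fin n → Fin n → Bool) → (Fin n → Fin n → Bool) → (Fin n → Fin n → Bool)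
stepR E R v w = R v w ∨ anyF (λ u → R v u ∧ E u w)

-- reflexive-transitive closure (paths of length 0..n suffice on n vertices)
rtcB : ∀ {n} → (Fin n → Fin n → Bool) → Fin n → Fin n → Bool
rtcB {n} E = iter n (stepR E) eqF

tcB : ∀ {n} → (Fin n → Fin n → Bool) → Fin n → Fin n → Bool
tcB {n} E = iter n (stepR E) E

IsHom : (G H : Digraph) → (V G → V H) → Set
IsHom G H f = ∀ v w → Arc G v w → Arc H (f v) (f w)

IsStrict : (G H : Digraph) → (V G → V H) → Set
IsStrict G H f = IsHom G H f × (∀ v w → Arc G v w → v ≢ w → f v ≢ f w)

Hom : Digraph → Digraph → Set
Hom G H = Σ (V G → V H) (IsHom G H)

SHom : Digraph → Digraph → Set
SHom G H = Σ (V G → V H) (IsStrict G H)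

module _ (G H G' H' : Digraph) {P : (V G → V H) → Set} {Q : (V G' → V H') → Set} where
  CongM : (Σ (V G → V H) P → Σ (V G' → V H') Q) → Set
  CongM f = ∀ x y → proj₁ x ≗ proj₁ y → proj₁ (f x) ≗ proj₁ (f y)

  InjM : (Σ (V G → V H) P → Σ (V G' → V H') Q) → Set
  InjM f = ∀ x y → proj₁ (f x) ≗ proj₁ (f y) → proj₁ x ≗ proj₁ y

-- Γ_ξ(v) as a Boolean predicate:  Γ G f v w = true  iff  w ∈ Γ_f(v),
-- i.e. w = v or w is joined to v by a sequence of consecutively adjacent
-- vertices inside the fibre f⁻¹(f(v)).

Γ : (G H : Digraph) → (V G → V H) → V G → V G → Bool
Γ G H f = rtcB (λ x y → eqF (f x) (f y) ∧ (adjB G x y ∨ adjB G y x))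

-- The quotient digraph 𝓖(ξ), encoded concretely: its vertices Γ_ξ(v) are
-- numbered 0,1,… in the order of their least elements.  It is built with an
-- adjacency-matrix modifier  mod  (identity for 𝓖(ξ), transitive hull for 𝓣(ξ)).

Modifier : Set
Modifier = ∀ {m} → Mat m → Mat m

idM : Modifier
idM M = M

tcM : Modifier
tcM M = tabulate (λ a → tabulate (λ b → tcB (λ x y → lookup (lookup M x) y) a b))

module _ (G H : Digraph) (f : V G → V H) where
  repr : V G → V G
  repr v = firstF (Γ G H f v)

  isRep : V G → Bool
  isRep v = eqF (repr v) v

  -- |V(𝓖(f))| - 1
  cnt : ℕ
  cnt = countF isRep ∸ 1

  πq : V G → Fin (suc cnt)
  πq v = clamp cnt (countF (λ u → isRep u ∧ ltF u (repr v)))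

  adj𝓖 : Mat cnt
  adj𝓖 = tabulate (λ a → tabulate (λ b →
           anyF (λ x → anyF (λ y → eqF (πq x) a ∧ eqF (πq y) b ∧ adjB G x y))))

  ιq : Fin (suc cnt) → V H
  ιq a = f (firstF (λ x → eqF (πq x) a))

𝓖 : Modifier → (G H : Digraph) → (V G → V H) → Digraph
𝓖 mod G H f = mkD (cnt G H f) (mod (adj𝓖 G H f))

IsPoset : Digraph → Set
IsPoset P = (∀ v → Arc P v v)
          × (∀ u v → Arc P u v → Arc P v u → u ≡ v)
          × (∀ u v w → Arc P u v → Arc P v w → Arc P u w)

star : Digraph → Digraph
star P = mkD (Digraph.m P)
  (tabulate (λ v → tabulate (λ w → adjB P v w ∧ not (eqF v w))))

InPStar : Digraph → Set
InPStar G = Σ Digraph (λ P → IsPoset P × (star P ≡ G))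

Iso : Digraph → Digraph → Set
Iso G H = Σ (V G → V H) (λ f → Σ (V H → V G) (λ g →
            (∀ v → g (f v) ≡ v) × (∀ w → f (g w) ≡ w)
          × (∀ v w → adjB G v w ≡ adjB H (f v) (f w))))

RepSystem : (D Dr : Digraph → Set) → Set
RepSystem D Dr = (∀ G → Dr G → D G)
               × (∀ G → D G → Σ Digraph (λ H → Dr H × Iso G H))
               × (∀ H H' → Dr H → Dr H' → Iso H H' → H ≡ H')

Scheme : (Dr : Digraph → Set) (R S : Digraph) → Set
Scheme Dr R S = ∀ G → Dr G → Hom G R → Hom G S

-- a well-defined (equality-respecting) strong Γ-scheme
IsStrongΓScheme : (Dr : Digraph → Set) (R S : Digraph) → Scheme Dr R S → Set
IsStrongΓScheme Dr R S ρ = ∀ G (p : Dr G) →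
    CongM G R G S (ρ G p) × InjM G R G S (ρ G p)
  × (∀ ξ v w → Γ G S (proj₁ (ρ G p ξ)) v w ≡ Γ G R (proj₁ ξ) v w)

SqsubΓ : (Dr : Digraph → Set) (R S : Digraph) → Set
SqsubΓ Dr R S = Σ (Scheme Dr R S) (IsStrongΓScheme Dr R S)

InG : Modifier → (D : Digraph → Set) (R g : Digraph) → Set
InG mod D R g = Σ Digraph (λ G → D G × Σ (Hom G R) (λ ξ → 𝓖 mod G R (proj₁ ξ) ≡ g))

Closed : Modifier → (D : Digraph → Set) (R : Digraph) → Set
Closed mod D R = ∀ G → D G → (ξ : Hom G R) → D (𝓖 mod G R (proj₁ ξ))

InjFamilies : Modifier → (D : Digraph → Set) (R S : Digraph) → Set
InjFamilies mod D R S = ∀ g → InG mod D R g →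
  Σ (SHom g R → SHom g S) (λ σ → CongM g R g S σ × InjM g R g S σ)

-- ι_ξ ∈ 𝓢(𝓖(ξ),R)  (well-definedness of the formula for ρ)
ιStrict : Modifier → (D : Digraph → Set) (R : Digraph) → Set
ιStrict mod D R = ∀ G → D G → (ξ : Hom G R) →
  IsStrict (𝓖 mod G R (proj₁ ξ)) R (ιq G R (proj₁ ξ))

-- a family (σ_𝔤)_{𝔤 ∈ 𝔊_D(R)}; it may formally receive the membership
-- proof, but is required not to depend on it
SigmaFam : Modifier → (D : Digraph → Set) (R S : Digraph) → Set
SigmaFam mod D R S = (g : Digraph) → InG mod D R g → SHom g R → SHom g S

SigmaFamOK : (mod : Modifier) (D : Digraph → Set) (R S : Digraph) → SigmaFam mod D R S → Set
SigmaFamOK mod D R S σ =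
    (∀ g (p : InG mod D R g) → CongM g R g S (σ g p) × InjM g R g S (σ g p))
  × (∀ g (p q : InG mod D R g) χ → proj₁ (σ g p χ) ≗ proj₁ (σ g q χ))

Conclusion : Modifier → (D Dr : Digraph → Set) (R : Digraph) → RepSystem D Dr → Set
Conclusion mod D Dr R rep =
  Σ (ιStrict mod D R) (λ ιs → ∀ (S : Digraph) →
      ((SqsubΓ Dr R S → InjFamilies mod D R S) × (InjFamilies mod D R S → SqsubΓ Dr R S))
    × ((σ : SigmaFam mod D R S) → SigmaFamOK mod D R S σ →
        Σ (Scheme Dr R S) (λ ρ → IsStrongΓScheme Dr R S ρ
          × (∀ G (p : Dr G) (ξ : Hom G R) (v : V G) →
               proj₁ (ρ G p ξ) v
               ≡ proj₁ (σ (𝓖 mod G R (proj₁ ξ)) (G , proj₁ rep G p , ξ , refl)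
                          (ιq G R (proj₁ ξ) , ιs G (proj₁ rep G p) ξ))
                       (πq G R (proj₁ ξ) v)))))

-- A homomorphism ξ : G → R factors as ι_ξ ∘ π_ξ through its quotient 𝓖(ξ), where ι_ξ is
-- strict; conversely, for every strict χ : 𝓖(ξ) → S the map χ ∘ π_ξ has the same Γ-classes as
-- ξ, and 𝓖(ξ) together with π_ξ depends only on these classes.  So a strong Γ-scheme ρ restricts
-- (after transport along g ≅ H ∈ 𝔇′_r) to injections σ_g between strict homomorphisms, and
-- injections σ_g give the strong Γ-scheme ρ_G(ξ) = σ_𝓖(ξ)(ι_ξ) ∘ π_ξ.  When σ_g may depend on
-- how g arises as a quotient, the scheme fixes that choice by taking the least homomorphism
-- with the Γ-classes of ξ.  For posets and 𝔓* the same works with 𝓣(ξ), because transitivity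
-- and antisymmetry (resp. irreflexivity) of R keep ι_ξ strict on the transitive hull.

module Submission where

open import Defs
open import Data.Product using (_×_; Σ; ∃; _,_; proj₁; proj₂)
open import Data.Bool using (Bool; true; false; _∧_; _∨_; not; T; if_then_else_)
import Data.Bool.Properties as B
open import Data.Bool.Properties using (T-≡; T-not-≡; T-∧; T-∨; T-irrelevant; ⇔→≡; ∧-zeroʳ)
open import Data.Empty using (⊥-elim)
open import Data.Fin using (Fin; zero; suc; toℕ)
open import Data.Fin.Properties using (_≟_; all?; ¬∀⟶∃¬; toℕ≤pred[n])
open import Data.Nat using (ℕ; zero; suc; _+_; _∸_; _≤_; _<_; z≤n; s≤s)
open import Data.Nat.Properties using (≤-trans; ≤-reflexive; m≤n⇒m≤1+n; <⇒≱; 0≢1+n; suc-injective; ∸-monoˡ-≤; m+[n∸m]≡n)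
open import Data.Product.Properties using (Σ-≡,≡→≡)
open import Data.Sum using (_⊎_; inj₁; inj₂)
open import Data.Vec using (Vec; []; _∷_; lookup; tabulate)
open import Data.Vec.Properties using (lookup∘tabulate; tabulate-cong)
open import Function using (_∘_; _⇔_; mk⇔; Equivalence)
open import Function.Definitions using (StrictlySurjective)
open import Function.Properties.Equivalence using () renaming (trans to ⇔-trans)
open import Relation.Binary.PropositionalEquality
open import Relation.Binary.Construct.Closure.ReflexiveTransitive using (Star; ε; _◅_; _◅◅_; return)
import Relation.Binary.Construct.Closure.ReflexiveTransitive as Star
open import Relation.Nullary using (¬_; Dec; does; yes; no; _because_)
open import Relation.Nullary.Decidable using (dec-false; T?; _→-dec_; decidable-stable)
open import Relation.Nullary.Reflects using (invert)
open import Relation.Unary using (_⊆_)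

open Equivalence using (to; from)

T-ext : ∀ {a b} → (T a → T b) → (T b → T a) → a ≡ b
T-ext ab ba = ⇔→≡ {z = true} (mk⇔ (to T-≡ ∘ ab ∘ from T-≡) (to T-≡ ∘ ba ∘ from T-≡))

T-does : ∀ {A : Set} (a? : Dec A) → T (does a?) ⇔ A
T-does (true  because [a])  = mk⇔ (λ _ → invert [a]) _
T-does (false because [¬a]) = mk⇔ (λ ()) (⊥-elim ∘ invert [¬a])

≡⇒eqF : ∀ {n} {i j : Fin n} → i ≡ j → T (eqF i j)
≡⇒eqF {i = i} {j} = from (T-does (i ≟ j))

eqF⇒≡ : ∀ {n} {i j : Fin n} → T (eqF i j) → i ≡ j
eqF⇒≡ {i = i} {j} = to (T-does (i ≟ j))

≗-⇔ : ∀ {A B : Set} {f₁ f₂ g₁ g₂ : A → B} → f₁ ≗ f₂ → g₁ ≗ g₂ → (f₁ ≗ g₁) ⇔ (f₂ ≗ g₂)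
≗-⇔ f₁≗f₂ g₁≗g₂ = mk⇔ (λ f≗g x → trans (sym (f₁≗f₂ x)) (trans (f≗g x) (g₁≗g₂ x)))
                      (λ f≗g x → trans (f₁≗f₂ x) (trans (f≗g x) (sym (g₁≗g₂ x))))

≗-∘-surjective : ∀ {A B C : Set} {π : A → B} → StrictlySurjective _≡_ π →
                 ∀ {α β : B → C} → α ∘ π ≗ β ∘ π → α ≗ β
≗-∘-surjective π-surjective {α} {β} α∘π≗β∘π b =
  let a , πa≡b = π-surjective b in subst (λ b → α b ≡ β b) πa≡b (α∘π≗β∘π a)

anyF⁺ : ∀ {n} (f : Fin n → Bool) (i : Fin n) → T (f i) → T (anyF f)
anyF⁺ f zero    fi = from T-∨ (inj₁ fi)
anyF⁺ f (suc i) fi = from (T-∨ {f zero}) (inj₂ (anyF⁺ (f ∘ suc) i fi))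

anyF⁻ : ∀ {n} (f : Fin n → Bool) → T (anyF f) → ∃ λ i → T (f i)
anyF⁻ {suc n} f t with to (T-∨ {f zero}) t
... | inj₁ f0 = zero , f0
... | inj₂ fs = let i , fi = anyF⁻ (f ∘ suc) fs in suc i , fi

anyF-cong : ∀ {n} {f g : Fin n → Bool} → f ≗ g → anyF f ≡ anyF g
anyF-cong {zero}  f≗g = refl
anyF-cong {suc n} f≗g = cong₂ _∨_ (f≗g zero) (anyF-cong (f≗g ∘ suc))

countF-cong : ∀ {n} {f g : Fin n → Bool} → f ≗ g → countF f ≡ countF g
countF-cong {zero}  f≗g = refl
countF-cong {suc n} f≗g = cong₂ (λ b k → (if b then 1 else 0) + k) (f≗g zero) (countF-cong (f≗g ∘ suc))

firstF-cong : ∀ {n} {f g : Fin (suc n) → Bool} → f ≗ g → firstF f ≡ firstF g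
firstF-cong {zero}  f≗g = refl
firstF-cong {suc n} f≗g = cong₂ (λ b i → if b then zero else suc i) (f≗g zero) (firstF-cong (f≗g ∘ suc))

firstF-satisfies : ∀ {n} (f : Fin (suc n) → Bool) (i : Fin (suc n)) → T (f i) → T (f (firstF f))
firstF-satisfies {zero}  f zero    fi = fi
firstF-satisfies {suc n} f i       fi with f zero in f0
... | true = from T-≡ f0
firstF-satisfies {suc n} f zero    fi | false = ⊥-elim (subst T f0 fi)
firstF-satisfies {suc n} f (suc i) fi | false = firstF-satisfies (f ∘ suc) i fi

countF≤ : ∀ {n} (f : Fin n → Bool) → countF f ≤ n
countF≤ {zero}  f = z≤n
countF≤ {suc n} f with f zero
... | true  = s≤s (countF≤ (f ∘ suc))
... | false = m≤n⇒m≤1+n (countF≤ (f ∘ suc))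

countF-mono : ∀ {n} (f g : Fin n → Bool) → T ∘ f ⊆ T ∘ g → countF f ≤ countF g
countF-mono {zero}  f g f⊆g = z≤n
countF-mono {suc n} f g f⊆g with f zero in f0 | g zero in g0
... | true  | true  = s≤s (countF-mono (f ∘ suc) (g ∘ suc) f⊆g)
... | true  | false = ⊥-elim (subst T g0 (f⊆g (from T-≡ f0)))
... | false | true  = m≤n⇒m≤1+n (countF-mono (f ∘ suc) (g ∘ suc) f⊆g)
... | false | false = countF-mono (f ∘ suc) (g ∘ suc) f⊆g

countF-mono-< : ∀ {n} (f g : Fin n → Bool) → T ∘ f ⊆ T ∘ g →
                (j : Fin n) → T (g j) → ¬ T (f j) → countF f < countF g
countF-mono-< {suc n} f g f⊆g j gj ¬fj with f zero in f0 | g zero in g0 | j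
... | true  | false | _     = ⊥-elim (subst T g0 (f⊆g (from T-≡ f0)))
... | true  | true  | zero  = ⊥-elim (¬fj (from T-≡ f0))
... | true  | true  | suc j = s≤s (countF-mono-< (f ∘ suc) (g ∘ suc) f⊆g j gj ¬fj)
... | false | false | zero  = ⊥-elim (subst T g0 gj)
... | false | false | suc j = countF-mono-< (f ∘ suc) (g ∘ suc) f⊆g j gj ¬fj
... | false | true  | zero  = s≤s (countF-mono (f ∘ suc) (g ∘ suc) f⊆g)
... | false | true  | suc j = m≤n⇒m≤1+n (countF-mono-< (f ∘ suc) (g ∘ suc) f⊆g j gj ¬fj)

countF-pos : ∀ {n} (f : Fin n → Bool) (i : Fin n) → T (f i) → 0 < countF f
countF-pos f i fi = ≤-trans (s≤s z≤n) (countF-mono-< (λ _ → false) f (λ ()) i fi (λ ()))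

allF : ∀ {n} → (Fin n → Bool) → Bool
allF {zero}  f = true
allF {suc n} f = f zero ∧ allF (f ∘ suc)

allF⁺ : ∀ {n} (f : Fin n → Bool) → (∀ i → T (f i)) → T (allF f)
allF⁺ {zero}  f all = _
allF⁺ {suc n} f all = from T-∧ (all zero , allF⁺ (f ∘ suc) (all ∘ suc))

allF⁻ : ∀ {n} (f : Fin n → Bool) → T (allF f) → ∀ i → T (f i)
allF⁻ f t zero    = proj₁ (to (T-∧ {f zero}) t)
allF⁻ f t (suc i) = allF⁻ (f ∘ suc) (proj₂ (to (T-∧ {f zero}) t)) i

allF-cong : ∀ {n} {f g : Fin n → Bool} → f ≗ g → allF f ≡ allF g
allF-cong {zero}  f≗g = refl
allF-cong {suc n} f≗g = cong₂ _∧_ (f≗g zero) (allF-cong (f≗g ∘ suc))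

module _ {k : ℕ} where

  anyV : ∀ n → (Vec (Fin (suc k)) n → Bool) → Bool
  anyV zero    P = P []
  anyV (suc n) P = anyF (λ i → anyV n (P ∘ (i ∷_)))

  anyV⁺ : ∀ n (P : Vec (Fin (suc k)) n → Bool) t → T (P t) → T (anyV n P)
  anyV⁺ zero    P []      Pt = Pt
  anyV⁺ (suc n) P (i ∷ t) Pt = anyF⁺ (λ i → anyV n (P ∘ (i ∷_))) i (anyV⁺ n (P ∘ (i ∷_)) t Pt)

  anyV-cong : ∀ n {P P′ : Vec (Fin (suc k)) n → Bool} → P ≗ P′ → anyV n P ≡ anyV n P′
  anyV-cong zero    P≗P′ = P≗P′ []
  anyV-cong (suc n) P≗P′ = anyF-cong (λ i → anyV-cong n (P≗P′ ∘ (i ∷_)))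

  -- the lexicographically least vector satisfying P (junk if there is none)
  firstV : ∀ n → (Vec (Fin (suc k)) n → Bool) → Vec (Fin (suc k)) n
  firstV zero    P = []
  firstV (suc n) P = i ∷ firstV n (P ∘ (i ∷_))
    where
    i : Fin (suc k)
    i = firstF (λ i → anyV n (P ∘ (i ∷_)))

  firstV-satisfies : ∀ n (P : Vec (Fin (suc k)) n → Bool) → T (anyV n P) → T (P (firstV n P))
  firstV-satisfies zero    P ∃t = ∃t
  firstV-satisfies (suc n) P ∃t =
    let j , Qj = anyF⁻ Q ∃t in firstV-satisfies n (P ∘ (firstF Q ∷_)) (firstF-satisfies Q j Qj)
    where
    Q : Fin (suc k) → Bool
    Q i = anyV n (P ∘ (i ∷_))

  firstV-cong : ∀ n {P P′ : Vec (Fin (suc k)) n → Bool} → P ≗ P′ → firstV n P ≡ firstV n P′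
  firstV-cong zero    P≗P′ = refl
  firstV-cong (suc n) {P} {P′} P≗P′ = cong₂ _∷_ i≡i′
    (trans (firstV-cong n (P≗P′ ∘ (i ∷_))) (cong (λ j → firstV n (P′ ∘ (j ∷_))) i≡i′))
    where
    i : Fin (suc k)
    i = firstF (λ i → anyV n (P ∘ (i ∷_)))
    i≡i′ : i ≡ firstF (λ i → anyV n (P′ ∘ (i ∷_)))
    i≡i′ = firstF-cong (λ i → anyV-cong n (P≗P′ ∘ (i ∷_)))

module Closure {n} (E : Fin n → Fin n → Bool) where

  _⟶_ : Fin n → Fin n → Set
  x ⟶ y = T (E x y)

  reach : ℕ → Fin n → Fin n → Bool
  reach k = iter k (stepR E) eqF

  reach-sound : ∀ k {v w} → T (reach k v w) → Star _⟶_ v w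
  reach-sound zero    {v} r = subst (Star _⟶_ v) (eqF⇒≡ r) ε
  reach-sound (suc k) {v} {w} r with to (T-∨ {reach k v w}) r
  ... | inj₁ r′ = reach-sound k r′
  ... | inj₂ r′ with anyF⁻ _ r′
  ... | u , ru = let r″ , e = to (T-∧ {reach k v u}) ru in reach-sound k r″ ◅◅ return e

  reach-step : ∀ k {v u w} → T (reach k v u) → u ⟶ w → T (reach (suc k) v w)
  reach-step k {v} {u} {w} r e =
    from (T-∨ {reach k v w}) (inj₂ (anyF⁺ (λ u → reach k v u ∧ E u w) u (from T-∧ (r , e))))

  reach-refl : ∀ k v → T (reach k v v)
  reach-refl zero    v = ≡⇒eqF {i = v} refl
  reach-refl (suc k) v = from T-∨ (inj₁ (reach-refl k v))

  Stable : ℕ → Fin n → Set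
  Stable k v = ∀ w → T (reach (suc k) v w) → T (reach k v w)

  stable-suc : ∀ k v → Stable k v → Stable (suc k) v
  stable-suc k v st w r with to (T-∨ {reach (suc k) v w}) r
  ... | inj₁ r′ = r′
  ... | inj₂ r′ with anyF⁻ _ r′
  ... | u , ru = let r″ , e = to (T-∧ {reach (suc k) v u}) ru in reach-step k (st u r″) e

  -- each non-stable step adds a vertex to the finite set reach k v
  stable-or-large : ∀ k v → Stable k v ⊎ k < countF (reach k v)
  stable-or-large zero    v = inj₂ (countF-pos _ v (reach-refl 0 v))
  stable-or-large (suc k) v with stable-or-large k v
  ... | inj₁ st = inj₁ (stable-suc k v st)
  ... | inj₂ large with all? (λ w → T? (reach (suc k) v w) →-dec T? (reach k v w))
  ... | yes st = inj₁ (stable-suc k v st)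
  ... | no ¬st =
    let w , ¬inc = ¬∀⟶∃¬ n _ (λ w → T? (reach (suc k) v w) →-dec T? (reach k v w)) ¬st
        new : T (reach (suc k) v w)
        new = decidable-stable (T? _) (λ ¬new → ¬inc (⊥-elim ∘ ¬new))
    in inj₂ (≤-trans (s≤s large) (countF-mono-< (reach k v) (reach (suc k) v)
                                     (from T-∨ ∘ inj₁) w new (λ old → ¬inc (λ _ → old))))

  stable-at-n : ∀ v → Stable n v
  stable-at-n v with stable-or-large n v
  ... | inj₁ st    = st
  ... | inj₂ large = ⊥-elim (<⇒≱ large (countF≤ (reach n v)))

  rtcB-closed : ∀ {v u w} → T (rtcB E v u) → u ⟶ w → T (rtcB E v w)
  rtcB-closed {v} r e = stable-at-n v _ (reach-step n r e)

  rtcB⇔Star : ∀ {v w} → T (rtcB E v w) ⇔ Star _⟶_ v w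
  rtcB⇔Star = mk⇔ (reach-sound n) (Star.foldl (λ v w → T (rtcB E v w)) rtcB-closed (reach-refl n _))

  tcB-sound : ∀ {v w} → T (tcB E v w) → ∃ λ u → v ⟶ u × Star _⟶_ u w
  tcB-sound = go n
    where
    go : ∀ k {v w} → T (iter k (stepR E) E v w) → ∃ λ u → v ⟶ u × Star _⟶_ u w
    go zero    {v} {w} e = w , e , ε
    go (suc k) {v} {w} r with to (T-∨ {iter k (stepR E) E v w}) r
    ... | inj₁ r′ = go k r′
    ... | inj₂ r′ with anyF⁻ _ r′
    ... | u , ru with to (T-∧ {iter k (stepR E) E v u}) ru
    ... | r″ , e = let u′ , e′ , s = go k r″ in u′ , e′ , s ◅◅ return e

  tcB-base : ∀ {v w} → v ⟶ w → T (tcB E v w)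
  tcB-base = go n
    where
    go : ∀ k {v w} → v ⟶ w → T (iter k (stepR E) E v w)
    go zero    e = e
    go (suc k) e = from T-∨ (inj₁ (go k e))

countF-false : ∀ {n} (f : Fin n → Bool) → (∀ i → f i ≡ false) → countF f ≡ 0
countF-false {zero}  f f≡false = refl
countF-false {suc n} f f≡false rewrite f≡false zero = countF-false (f ∘ suc) (f≡false ∘ suc)

rank : ∀ {n} → (Fin n → Bool) → Fin n → ℕ
rank h w = countF (λ u → h u ∧ ltF u w)

rank-zero : ∀ {n} (h : Fin (suc n) → Bool) → rank h zero ≡ 0
rank-zero h = countF-false _ (λ i → ∧-zeroʳ (h i))

rank<countF : ∀ {n} (h : Fin n → Bool) (w : Fin n) → T (h w) → rank h w < countF h
rank<countF {suc n} h zero    hw rewrite rank-zero h with h zero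
... | true = s≤s z≤n
rank<countF {suc n} h (suc w) hw with h zero
... | true  = s≤s (rank<countF (h ∘ suc) w hw)
... | false = rank<countF (h ∘ suc) w hw

rank-injective : ∀ {n} (h : Fin n → Bool) {w w′ : Fin n} → T (h w) → T (h w′) →
                 rank h w ≡ rank h w′ → w ≡ w′
rank-injective {suc n} h {zero}  {zero}   hw hw′ eq = refl
rank-injective {suc n} h {zero}  {suc w′} hw hw′ eq rewrite rank-zero h with h zero
... | true = ⊥-elim (0≢1+n eq)
rank-injective {suc n} h {suc w} {zero}   hw hw′ eq rewrite rank-zero h with h zero
... | true = ⊥-elim (0≢1+n (sym eq))
rank-injective {suc n} h {suc w} {suc w′} hw hw′ eq with h zero
... | true  = cong suc (rank-injective (h ∘ suc) hw hw′ (suc-injective eq))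
... | false = cong suc (rank-injective (h ∘ suc) hw hw′ eq)

rank-surjective : ∀ {n} (h : Fin n → Bool) (j : ℕ) → j < countF h → ∃ λ w → T (h w) × rank h w ≡ j
rank-surjective {suc n} h j j<c with h zero in h0
rank-surjective {suc n} h zero    j<c       | true = zero , from T-≡ h0 , countF-false _ (λ i → ∧-zeroʳ (h (suc i)))
rank-surjective {suc n} h (suc j) (s≤s j<c) | true =
  let w , hw , eq = rank-surjective (h ∘ suc) j j<c in suc w , hw , cong suc eq
rank-surjective {suc n} h j       j<c       | false =
  let w , hw , eq = rank-surjective (h ∘ suc) j j<c in suc w , hw , eq

toℕ-clamp : ∀ k {j} → j ≤ k → toℕ (clamp k j) ≡ j
toℕ-clamp zero    {zero}  _         = refl
toℕ-clamp (suc k) {zero}  _         = refl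
toℕ-clamp (suc k) {suc j} (s≤s j≤k) = cong suc (toℕ-clamp k j≤k)

clamp-toℕ : ∀ k (a : Fin (suc k)) → clamp k (toℕ a) ≡ a
clamp-toℕ zero    zero    = refl
clamp-toℕ (suc k) zero    = refl
clamp-toℕ (suc k) (suc a) = cong suc (clamp-toℕ k a)

module Fibres (G H : Digraph) (f : V G → V H) where

  linkedB : V G → V G → Bool
  linkedB x y = eqF (f x) (f y) ∧ (adjB G x y ∨ adjB G y x)

  Linked : V G → V G → Set
  Linked x y = T (linkedB x y)

  linked⁺ : ∀ {x y} → f x ≡ f y → Arc G x y ⊎ Arc G y x → Linked x y
  linked⁺ {x} {y} fx≡fy arc = from T-∧ (≡⇒eqF {i = f x} fx≡fy , from T-∨ arc)

  linked⁻ : ∀ {x y} → Linked x y → f x ≡ f y × (Arc G x y ⊎ Arc G y x)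
  linked⁻ {x} {y} l = let e , a = to (T-∧ {eqF (f x) (f y)}) l in eqF⇒≡ e , to T-∨ a

  linked-sym : ∀ {x y} → Linked x y → Linked y x
  linked-sym l with linked⁻ l
  ... | fx≡fy , inj₁ a = linked⁺ (sym fx≡fy) (inj₂ a)
  ... | fx≡fy , inj₂ a = linked⁺ (sym fx≡fy) (inj₁ a)

  Γ⇔Star : ∀ {v w} → T (Γ G H f v w) ⇔ Star Linked v w
  Γ⇔Star = Closure.rtcB⇔Star linkedB

  Γ-refl : ∀ v → T (Γ G H f v v)
  Γ-refl v = from Γ⇔Star ε

  Γ-sym : ∀ {v w} → T (Γ G H f v w) → T (Γ G H f w v)
  Γ-sym = from Γ⇔Star ∘ Star.reverse linked-sym ∘ to Γ⇔Star

  Γ-trans : ∀ {u v w} → T (Γ G H f u v) → T (Γ G H f v w) → T (Γ G H f u w)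
  Γ-trans p q = from Γ⇔Star (to Γ⇔Star p ◅◅ to Γ⇔Star q)

  linked⇒Γ : ∀ {v w} → Linked v w → T (Γ G H f v w)
  linked⇒Γ = from Γ⇔Star ∘ return

  Γ⇒≡ : ∀ {v w} → T (Γ G H f v w) → f v ≡ f w
  Γ⇒≡ = Star.fold (λ v w → f v ≡ f w) (trans ∘ proj₁ ∘ linked⁻) refl ∘ to Γ⇔Star

  Γ-class-cong : ∀ {v w} → T (Γ G H f v w) → Γ G H f v ≗ Γ G H f w
  Γ-class-cong vw u = T-ext (Γ-trans (Γ-sym vw)) (Γ-trans vw)

  repr-Γ : ∀ v → T (Γ G H f v (repr G H f v))
  repr-Γ v = firstF-satisfies (Γ G H f v) v (Γ-refl v)

  repr-cong : ∀ {v w} → T (Γ G H f v w) → repr G H f v ≡ repr G H f w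
  repr-cong = firstF-cong ∘ Γ-class-cong

  repr-≡⇒Γ : ∀ {v w} → repr G H f v ≡ repr G H f w → T (Γ G H f v w)
  repr-≡⇒Γ {v} {w} eq = Γ-trans (repr-Γ v) (subst (λ r → T (Γ G H f r w)) (sym eq) (Γ-sym (repr-Γ w)))

  isRep-repr : ∀ v → T (isRep G H f (repr G H f v))
  isRep-repr v = ≡⇒eqF (sym (repr-cong (repr-Γ v)))

  πq-≡⇒Γ : ∀ {x y} → πq G H f x ≡ πq G H f y → T (Γ G H f x y)
  πq-≡⇒Γ {x} {y} eq = repr-≡⇒Γ (rank-injective (isRep G H f) (isRep-repr x) (isRep-repr y)
    (trans (sym (toℕ-πq x)) (trans (cong toℕ eq) (toℕ-πq y))))
    where
    toℕ-πq : ∀ v → toℕ (πq G H f v) ≡ rank (isRep G H f) (repr G H f v)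
    toℕ-πq v = toℕ-clamp (cnt G H f)
      (∸-monoˡ-≤ 1 (rank<countF (isRep G H f) (repr G H f v) (isRep-repr v)))

  Γ⇒πq-≡ : ∀ {x y} → T (Γ G H f x y) → πq G H f x ≡ πq G H f y
  Γ⇒πq-≡ = cong (clamp (cnt G H f) ∘ rank (isRep G H f)) ∘ repr-cong

  πq-surjective : StrictlySurjective _≡_ (πq G H f)
  πq-surjective a =
    let r , rep , rank≡a = rank-surjective (isRep G H f) (toℕ a) a<count
    in r , trans (cong (clamp (cnt G H f) ∘ rank (isRep G H f)) (eqF⇒≡ {i = repr G H f r} rep))
                 (trans (cong (clamp (cnt G H f)) rank≡a) (clamp-toℕ (cnt G H f) a))
    where
    count-pos : 1 ≤ countF (isRep G H f)
    count-pos = countF-pos (isRep G H f) (repr G H f zero) (isRep-repr zero)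
    a<count : toℕ a < countF (isRep G H f)
    a<count = ≤-trans (s≤s (toℕ≤pred[n] a)) (≤-reflexive (m+[n∸m]≡n count-pos))

linked-cong : ∀ G H {f f′ : V G → V H} → f ≗ f′ → ∀ {x y} → Fibres.Linked G H f x y → Fibres.Linked G H f′ x y
linked-cong G H {f} {f′} f≗f′ {x} {y} l =
  let fx≡fy , arc = Fibres.linked⁻ G H f {x} {y} l
  in Fibres.linked⁺ G H f′ {x} {y} (trans (sym (f≗f′ x)) (trans fx≡fy (f≗f′ y))) arc

Γ-cong : ∀ G H {f f′ : V G → V H} → f ≗ f′ → ∀ v w → Γ G H f v w ≡ Γ G H f′ v w
Γ-cong G H {f} {f′} f≗f′ v w = T-ext
  (from F′.Γ⇔Star ∘ Star.map (linked-cong G H f≗f′) ∘ to F.Γ⇔Star)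
  (from F.Γ⇔Star ∘ Star.map (linked-cong G H (sym ∘ f≗f′)) ∘ to F′.Γ⇔Star)
  where
  module F  = Fibres G H f
  module F′ = Fibres G H f′

lookup²∘tabulate² : ∀ {n} {A : Set} (F : Fin n → Fin n → A) a b →
                    lookup (lookup (tabulate (tabulate ∘ F)) a) b ≡ F a b
lookup²∘tabulate² F a b = trans (cong (λ row → lookup row b) (lookup∘tabulate (tabulate ∘ F) a))
                                (lookup∘tabulate (F a) b)

module _ (G H : Digraph) (f : V G → V H) where

  private
    arcB : Fin (suc (cnt G H f)) → Fin (suc (cnt G H f)) → V G → V G → Bool
    arcB a b x y = eqF (πq G H f x) a ∧ eqF (πq G H f y) b ∧ adjB G x y

    entry : ∀ a b → adjB (𝓖 idM G H f) a b ≡ anyF (λ x → anyF (arcB a b x))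
    entry = lookup²∘tabulate² (λ a b → anyF (λ x → anyF (arcB a b x)))

  quotient-arc⁺ : IsHom G (𝓖 idM G H f) (πq G H f)
  quotient-arc⁺ x y arc = subst T (sym (entry a b))
    (anyF⁺ (λ x → anyF (arcB a b x)) x (anyF⁺ (arcB a b x) y (from T-∧ (≡⇒eqF {i = a} refl , from T-∧ (≡⇒eqF {i = b} refl , arc)))))
    where
    a = πq G H f x
    b = πq G H f y

  quotient-arc⁻ : ∀ a b → Arc (𝓖 idM G H f) a b →
                  ∃ λ x → ∃ λ y → πq G H f x ≡ a × πq G H f y ≡ b × Arc G x y
  quotient-arc⁻ a b arc =
    let x , ∃y = anyF⁻ (λ x → anyF (arcB a b x)) (subst T (entry a b) arc)
        y , p  = anyF⁻ (arcB a b x) ∃y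
        πx , q = to (T-∧ {eqF (πq G H f x) a}) p
        πy , xy = to (T-∧ {eqF (πq G H f y) b}) q
    in x , y , eqF⇒≡ {i = πq G H f x} πx , eqF⇒≡ {i = πq G H f y} πy , xy

Extensive : Modifier → Set
Extensive mod = ∀ {m} (M : Mat m) a b → T (lookup (lookup M a) b) → T (lookup (lookup (mod M) a) b)

idM-extensive : Extensive idM
idM-extensive M a b arc = arc

module _ {m} (M : Mat m) where

  private
    E : Fin (suc m) → Fin (suc m) → Bool
    E a b = lookup (lookup M a) b

    _⟶_ : Fin (suc m) → Fin (suc m) → Set
    a ⟶ b = T (E a b)

  tcM-arc⁻ : ∀ a b → T (lookup (lookup (tcM M) a) b) → ∃ λ u → a ⟶ u × Star _⟶_ u b
  tcM-arc⁻ a b = Closure.tcB-sound E ∘ subst T (lookup²∘tabulate² (tcB E) a b)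

  tcM-arc⁺ : ∀ a b → a ⟶ b → T (lookup (lookup (tcM M) a) b)
  tcM-arc⁺ a b = subst T (sym (lookup²∘tabulate² (tcB E) a b)) ∘ Closure.tcB-base E

tcM-extensive : Extensive tcM
tcM-extensive = tcM-arc⁺

πq-hom : ∀ (mod : Modifier) → Extensive mod → ∀ G H f → IsHom G (𝓖 mod G H f) (πq G H f)
πq-hom mod ext G H f x y = ext (adj𝓖 G H f) (πq G H f x) (πq G H f y) ∘ quotient-arc⁺ G H f x y

ArcTransitive : Digraph → Set
ArcTransitive R = ∀ x y z → Arc R x y → Arc R y z → Arc R x z

module _ (P : Digraph) where

  private
    entry : ∀ x y → adjB (star P) x y ≡ (adjB P x y ∧ not (eqF x y))
    entry = lookup²∘tabulate² (λ x y → adjB P x y ∧ not (eqF x y))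

  star-arc⁻ : ∀ x y → Arc (star P) x y → Arc P x y × x ≢ y
  star-arc⁻ x y arc =
    let xy , x≠y = to (T-∧ {adjB P x y}) (subst T (entry x y) arc)
    in xy , λ { refl → subst (T ∘ not) (to T-≡ (≡⇒eqF {i = x} refl)) x≠y }

  star-arc⁺ : ∀ x y → Arc P x y → x ≢ y → Arc (star P) x y
  star-arc⁺ x y xy x≢y = subst T (sym (entry x y))
    (from T-∧ (xy , from T-not-≡ (dec-false (x ≟ y) x≢y)))

  star-transitive : IsPoset P → ArcTransitive (star P)
  star-transitive (_ , antisym , trans-P) x y z xy yz =
    let xy′ , x≢y = star-arc⁻ x y xy
        yz′ , _   = star-arc⁻ y z yz
    in star-arc⁺ x z (trans-P x y z xy′ yz′) λ { refl → x≢y (antisym x y xy′ yz′) }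

SameΓ : (G R : Digraph) → (V G → V R) → (V G → V R) → Set
SameΓ G R f f′ = ∀ v w → Γ G R f v w ≡ Γ G R f′ v w

-- ιq G R f is, by definition, induced G R f f
induced : (G R : Digraph) (f₀ f : V G → V R) → Fin (suc (cnt G R f₀)) → V R
induced G R f₀ f a = f (firstF (λ x → eqF (πq G R f₀ x) a))

module Induced (G R : Digraph) (f₀ f : V G → V R) (same : SameΓ G R f₀ f) where

  private
    module F₀ = Fibres G R f₀
    module F  = Fibres G R f

  ind : Fin (suc (cnt G R f₀)) → V R
  ind = induced G R f₀ f

  induced∘πq : ∀ v → ind (πq G R f₀ v) ≡ f v
  induced∘πq v = F.Γ⇒≡ (subst T (same x v) (F₀.πq-≡⇒Γ (eqF⇒≡ {i = πq G R f₀ x} x-in-class)))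
    where
    inClass : V G → Bool
    inClass x = eqF (πq G R f₀ x) (πq G R f₀ v)
    x : V G
    x = firstF inClass
    x-in-class : T (inClass x)
    x-in-class = firstF-satisfies inClass v (≡⇒eqF {i = πq G R f₀ v} refl)

  induced-arc-≡ : ∀ a b → Arc (𝓖 idM G R f₀) a b → ind a ≡ ind b → a ≡ b
  induced-arc-≡ a b arc eq =
    let x , y , πx≡a , πy≡b , xy = quotient-arc⁻ G R f₀ a b arc
        fx≡fy = begin
          f x               ≡⟨ sym (induced∘πq x) ⟩
          ind (πq G R f₀ x) ≡⟨ cong ind πx≡a ⟩
          ind a             ≡⟨ eq ⟩
          ind b             ≡⟨ cong ind (sym πy≡b) ⟩
          ind (πq G R f₀ y) ≡⟨ induced∘πq y ⟩
          f y               ∎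
    in trans (sym πx≡a) (trans (F₀.Γ⇒πq-≡ (subst T (sym (same x y)) (F.linked⇒Γ (F.linked⁺ fx≡fy (inj₁ xy))))) πy≡b)
    where open ≡-Reasoning

  module _ (hom : IsHom G R f) where

    induced-arc : IsHom (𝓖 idM G R f₀) R ind
    induced-arc a b arc =
      let x , y , πx≡a , πy≡b , xy = quotient-arc⁻ G R f₀ a b arc
      in subst₂ (λ a b → Arc R (ind a) (ind b)) πx≡a πy≡b
           (subst₂ (Arc R) (sym (induced∘πq x)) (sym (induced∘πq y)) (hom x y xy))

    induced-walk : ArcTransitive R → ∀ {a u b} →
                   Arc R (ind a) (ind u) → Star (Arc (𝓖 idM G R f₀)) u b → Arc R (ind a) (ind b)
    induced-walk trans-R r ε        = r
    induced-walk trans-R {a} {u} r (_◅_ {j = v} uv s) =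
      induced-walk trans-R (trans-R (ind a) (ind u) (ind v) r (induced-arc u v uv)) s

    induced-tc-arc : ArcTransitive R → IsHom (𝓖 tcM G R f₀) R ind
    induced-tc-arc trans-R a b arc =
      let u , au , ub = tcM-arc⁻ (adj𝓖 G R f₀) a b arc in induced-walk trans-R (induced-arc a u au) ub

    -- by antisymmetry a walk with closed image has constant image, and arcs with constant image are loops
    induced-walk-≡ : IsPoset R → ∀ {a b} → Star (Arc (𝓖 idM G R f₀)) a b → ind a ≡ ind b → a ≡ b
    induced-walk-≡ _ ε _ = refl
    induced-walk-≡ poset@(refl-R , antisym , trans-R) {a} {b} (_◅_ {j = u} au ub) eq =
      let ind-a≡ind-u = antisym (ind a) (ind u) (induced-arc a u au)
            (subst (Arc R (ind u)) (sym eq) (induced-walk trans-R (refl-R (ind u)) ub))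
      in trans (induced-arc-≡ a u au ind-a≡ind-u) (induced-walk-≡ poset ub (trans (sym ind-a≡ind-u) eq))

InducedStrict : Modifier → Digraph → Set
InducedStrict mod R = ∀ G (f₀ f : V G → V R) → SameΓ G R f₀ f → IsHom G R f →
                      IsStrict (𝓖 mod G R f₀) R (induced G R f₀ f)

induced-strict-idM : ∀ R → InducedStrict idM R
induced-strict-idM R G f₀ f same hom =
  induced-arc hom , λ a b arc a≢b eq → a≢b (induced-arc-≡ a b arc eq)
  where open Induced G R f₀ f same

induced-strict-poset : ∀ R → IsPoset R → InducedStrict tcM R
induced-strict-poset R poset@(_ , _ , trans-R) G f₀ f same hom =
  induced-tc-arc hom trans-R , λ a b arc a≢b eq →
    let u , au , ub = tcM-arc⁻ (adj𝓖 G R f₀) a b arc in a≢b (induced-walk-≡ hom poset (au ◅ ub) eq)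
  where open Induced G R f₀ f same

induced-strict-star : ∀ R → InPStar R → InducedStrict tcM R
induced-strict-star .(star P) (P , poset , refl) G f₀ f same hom =
  induced-tc-arc hom (star-transitive P poset) , λ a b arc _ eq →
    proj₂ (star-arc⁻ P (ind a) (ind b) (induced-tc-arc hom (star-transitive P poset) a b arc)) eq
  where open Induced G (star P) f₀ f same

strict⇒Γ-trivial : ∀ K L {c : V K → V L} → IsStrict K L c → ∀ {x y} → T (Γ K L c x y) → x ≡ y
strict⇒Γ-trivial K L {c} (_ , proper) =
  Star.fold _≡_ (λ l y≡z → trans (linked-≡ l) y≡z) refl ∘ to Γ⇔Star
  where
  open Fibres K L c
  linked-≡ : ∀ {x y} → Linked x y → x ≡ y
  linked-≡ {x} {y} l with x ≟ y | linked⁻ {x} {y} l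
  ... | yes x≡y | _              = x≡y
  ... | no x≢y  | cx≡cy , inj₁ a = ⊥-elim (proper x y a x≢y cx≡cy)
  ... | no x≢y  | cx≡cy , inj₂ a = ⊥-elim (proper y x a (x≢y ∘ sym) (sym cx≡cy))

strict-if-sameΓ : ∀ K L M {χ : V K → V L} {ψ : V K → V M} → IsStrict K L χ → IsHom K M ψ →
                  (∀ v w → Γ K M ψ v w ≡ Γ K L χ v w) → IsStrict K M ψ
strict-if-sameΓ K L M {ψ = ψ} χ-strict ψ-hom same = ψ-hom , λ x y xy x≢y ψx≡ψy →
  x≢y (strict⇒Γ-trivial K L χ-strict (subst T (same x y) (linked⇒Γ (linked⁺ {x} {y} ψx≡ψy (inj₁ xy)))))
  where open Fibres K M ψ

module _ (mod : Modifier) (ext : Extensive mod) (G R S : Digraph) (f : V G → V R)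
         {χ : V (𝓖 mod G R f) → V S} (χ-strict : IsStrict (𝓖 mod G R f) S χ) where

  private
    module F = Fibres G R f
    module Fχ = Fibres G S (χ ∘ πq G R f)

    πq-≡ : ∀ x y → Arc G x y → χ (πq G R f x) ≡ χ (πq G R f y) → πq G R f x ≡ πq G R f y
    πq-≡ x y xy eq with πq G R f x ≟ πq G R f y
    ... | yes πx≡πy = πx≡πy
    ... | no πx≢πy  = ⊥-elim (proj₂ χ-strict (πq G R f x) (πq G R f y) (πq-hom mod ext G R f x y xy) πx≢πy eq)

    linked-χ⇒Γ : ∀ {x y} → Fχ.Linked x y → T (Γ G R f x y)
    linked-χ⇒Γ {x} {y} l with Fχ.linked⁻ {x} {y} l
    ... | eq , inj₁ xy = F.πq-≡⇒Γ {x} {y} (πq-≡ x y xy eq)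
    ... | eq , inj₂ yx = F.πq-≡⇒Γ {x} {y} (sym (πq-≡ y x yx (sym eq)))

    linked⇒linked-χ : ∀ {x y} → F.Linked x y → Fχ.Linked x y
    linked⇒linked-χ {x} {y} l =
      Fχ.linked⁺ {x} {y} (cong χ (F.Γ⇒πq-≡ {x} {y} (F.linked⇒Γ l))) (proj₂ (F.linked⁻ {x} {y} l))

  Γ-strict∘πq : ∀ v w → Γ G S (χ ∘ πq G R f) v w ≡ Γ G R f v w
  Γ-strict∘πq v w = T-ext
    (Star.foldl (λ v w → T (Γ G R f v w)) (λ p l → F.Γ-trans p (linked-χ⇒Γ l)) (F.Γ-refl _) ∘ to Fχ.Γ⇔Star)
    (from Fχ.Γ⇔Star ∘ Star.map linked⇒linked-χ ∘ to F.Γ⇔Star)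

PreservesΓ : ∀ G R S → (Hom G R → Hom G S) → Set
PreservesΓ G R S ρ = ∀ ξ v w → Γ G S (proj₁ (ρ ξ)) v w ≡ Γ G R (proj₁ ξ) v w

IsStrongΓ : ∀ G R S → (Hom G R → Hom G S) → Set
IsStrongΓ G R S ρ = CongM G R G S ρ × InjM G R G S ρ × PreservesΓ G R S ρ

StrictInjection : (g R S : Digraph) → Set
StrictInjection g R S = Σ (SHom g R → SHom g S) (λ σ → CongM g R g S σ × InjM g R g S σ)

strongΓ⇒StrictInjection : ∀ H R S (ρ : Hom H R → Hom H S) → IsStrongΓ H R S ρ → StrictInjection H R S
strongΓ⇒StrictInjection H R S ρ (ρ-cong , ρ-inj , ρ-Γ) = σ , σ-cong , σ-inj
  where
  hom : SHom H R → Hom H R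
  hom (χ , χ-hom , _) = χ , χ-hom
  σ : SHom H R → SHom H S
  σ χ = proj₁ (ρ (hom χ)) , strict-if-sameΓ H R S (proj₂ χ) (proj₂ (ρ (hom χ))) (ρ-Γ (hom χ))
  σ-cong : CongM H R H S σ
  σ-cong χ χ′ = ρ-cong (hom χ) (hom χ′)
  σ-inj : InjM H R H S σ
  σ-inj χ χ′ = ρ-inj (hom χ) (hom χ′)

Iso-sym : ∀ K L → Iso K L → Iso L K
Iso-sym K L (h , h⁻ , h⁻∘h , h∘h⁻ , adj) = h⁻ , h , h∘h⁻ , h⁻∘h , λ u w →
  sym (trans (adj (h⁻ u) (h⁻ w)) (cong₂ (adjB L) (h∘h⁻ u) (h∘h⁻ w)))

strict∘iso : ∀ K L M (iso : Iso K L) {ψ : V L → V M} → IsStrict L M ψ → IsStrict K M (ψ ∘ proj₁ iso)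
strict∘iso K L M (h , h⁻ , h⁻∘h , _ , adj) (ψ-hom , ψ-proper) =
  (λ a b ab → ψ-hom (h a) (h b) (subst T (adj a b) ab)) ,
  (λ a b ab a≢b → ψ-proper (h a) (h b) (subst T (adj a b) ab)
                    (λ ha≡hb → a≢b (trans (sym (h⁻∘h a)) (trans (cong h⁻ ha≡hb) (h⁻∘h b)))))

StrictInjection-iso : ∀ K L R S → Iso K L → StrictInjection L R S → StrictInjection K R S
StrictInjection-iso K L R S iso@(h , h⁻ , h⁻∘h , h∘h⁻ , _) (σ , σ-cong , σ-inj) = σ′ , σ′-cong , σ′-inj
  where
  pull : SHom K R → SHom L R
  pull (χ , χ-strict) = χ ∘ h⁻ , strict∘iso L K R (Iso-sym K L iso) χ-strict
  σ′ : SHom K R → SHom K S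
  σ′ χ = proj₁ (σ (pull χ)) ∘ h , strict∘iso K L S iso (proj₂ (σ (pull χ)))
  σ′-cong : CongM K R K S σ′
  σ′-cong χ χ′ χ≗χ′ = σ-cong (pull χ) (pull χ′) (χ≗χ′ ∘ h⁻) ∘ h
  σ′-inj : InjM K R K S σ′
  σ′-inj χ χ′ eq a = begin
    proj₁ χ a          ≡⟨ cong (proj₁ χ) (sym (h⁻∘h a)) ⟩
    proj₁ χ (h⁻ (h a))  ≡⟨ σ-inj (pull χ) (pull χ′) eq-L (h a) ⟩
    proj₁ χ′ (h⁻ (h a)) ≡⟨ cong (proj₁ χ′) (h⁻∘h a) ⟩
    proj₁ χ′ a          ∎
    where
    open ≡-Reasoning
    eq-L : ∀ u → proj₁ (σ (pull χ)) u ≡ proj₁ (σ (pull χ′)) u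
    eq-L u = subst (λ u → proj₁ (σ (pull χ)) u ≡ proj₁ (σ (pull χ′)) u) (h∘h⁻ u) (eq (h⁻ u))

⊑Γ⇒InjFamilies : ∀ (mod : Modifier) (D Dr : Digraph → Set) R (rep : RepSystem D Dr) S →
                  Closed mod D R → SqsubΓ Dr R S → InjFamilies mod D R S
⊑Γ⇒InjFamilies mod D Dr R (_ , represent , _) S closed (ρ , ρ-strong) .(𝓖 mod G R f) (G , dG , ξ@(f , _) , refl) =
  let H , drH , g≅H = represent (𝓖 mod G R f) (closed G dG ξ)
  in StrictInjection-iso (𝓖 mod G R f) H R S g≅H (strongΓ⇒StrictInjection H R S (ρ H drH) (ρ-strong H drH))

StrictInjection-∘-surjective : ∀ G g R S {π : V G → V g} → StrictlySurjective _≡_ π →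
  (inj : StrictInjection g R S) → ∀ χ χ′ →
  (proj₁ χ ∘ π ≗ proj₁ χ′ ∘ π) ⇔ (proj₁ (proj₁ inj χ) ∘ π ≗ proj₁ (proj₁ inj χ′) ∘ π)
StrictInjection-∘-surjective G g R S {π} π-surjective (σ , σ-cong , σ-inj) χ χ′ =
  mk⇔ (λ eq → σ-cong χ χ′ (≗-∘-surjective π-surjective eq) ∘ π)
      (λ eq → σ-inj χ χ′ (≗-∘-surjective π-surjective eq) ∘ π)

-- Γ-preservation reduces congruence and injectivity to pairs with the same Γ-classes
strongΓ-scheme : ∀ G R S (ρ : Hom G R → Hom G S) →
  PreservesΓ G R S ρ →
  (∀ ξ ξ′ → SameΓ G R (proj₁ ξ) (proj₁ ξ′) → (proj₁ ξ ≗ proj₁ ξ′) ⇔ (proj₁ (ρ ξ) ≗ proj₁ (ρ ξ′))) →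
  IsStrongΓ G R S ρ
strongΓ-scheme G R S ρ ρ-Γ ρ-⇔ = ρ-cong , ρ-inj , ρ-Γ
  where
  ρ-cong : CongM G R G S ρ
  ρ-cong ξ ξ′ ξ≗ξ′ = to (ρ-⇔ ξ ξ′ (Γ-cong G R ξ≗ξ′)) ξ≗ξ′
  ρ-inj : InjM G R G S ρ
  ρ-inj ξ ξ′ ρξ≗ρξ′ = from (ρ-⇔ ξ ξ′ same) ρξ≗ρξ′
    where
    same : SameΓ G R (proj₁ ξ) (proj₁ ξ′)
    same v w = trans (sym (ρ-Γ ξ v w)) (trans (Γ-cong G S ρξ≗ρξ′ v w) (ρ-Γ ξ′ v w))

QuotientData : Digraph → Set
QuotientData G = Σ Digraph (λ g → Vec (V g) (suc (Digraph.m G)))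

quotientData : Modifier → (G R : Digraph) → (V G → V R) → QuotientData G
quotientData mod G R f = 𝓖 mod G R f , tabulate (πq G R f)

module _ (mod : Modifier) (G R : Digraph) where

  -- quotientData mod G R f is, by definition, quotientBy (cnt G R f) (rank (isRep G R f) ∘ repr G R f)
  quotientBy : ℕ → (V G → ℕ) → QuotientData G
  quotientBy c N =
    mkD c (mod (tabulate λ a → tabulate λ b → anyF λ x → anyF λ y →
                  eqF (clamp c (N x)) a ∧ eqF (clamp c (N y)) b ∧ adjB G x y)) ,
    tabulate (clamp c ∘ N)

  quotientBy-cong : ∀ {c c′ N N′} → c ≡ c′ → N ≗ N′ → quotientBy c N ≡ quotientBy c′ N′
  quotientBy-cong {c} refl N≗N′ = cong₂ (λ M π → mkD c (mod M) , π)
    (tabulate-cong λ a → tabulate-cong λ b → anyF-cong λ x → anyF-cong λ y →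
       cong₂ (λ p q → eqF (clamp c p) a ∧ eqF (clamp c q) b ∧ adjB G x y) (N≗N′ x) (N≗N′ y))
    (tabulate-cong (cong (clamp c) ∘ N≗N′))

  quotientData-Γ-determined : ∀ {f f′} → SameΓ G R f f′ → quotientData mod G R f ≡ quotientData mod G R f′
  quotientData-Γ-determined {f} {f′} same = quotientBy-cong
    (cong (_∸ 1) (countF-cong isRep≗))
    (λ v → countF-cong (λ u → cong₂ (λ r s → r ∧ ltF u s) (isRep≗ u) (repr≗ v)))
    where
    repr≗ : repr G R f ≗ repr G R f′
    repr≗ v = firstF-cong (same v)
    isRep≗ : isRep G R f ≗ isRep G R f′
    isRep≗ u = cong (λ r → eqF r u) (repr≗ u)

ι-strict : ∀ (mod : Modifier) (D : Digraph → Set) R → InducedStrict mod R → ιStrict mod D R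
ι-strict mod D R ind G _ (f , f-hom) = ind G f f (λ _ _ → refl) f-hom

module FormulaScheme (mod : Modifier) (ext : Extensive mod) (D Dr : Digraph → Set) (R : Digraph)
                     (rep : RepSystem D Dr) (ind : InducedStrict mod R) (S : Digraph)
                     (σ : SigmaFam mod D R S) (σ-ok : SigmaFamOK mod D R S σ) where

  -- once the quotient data are identified, σ no longer depends on the membership witness
  transfer : ∀ {G g g′} {π : V G → V g} {π′ : V G → V g′}
    (t : Vec (V g) (suc (Digraph.m G))) (t′ : Vec (V g′) (suc (Digraph.m G))) →
    (g , t) ≡ (g′ , t′) → lookup t ≗ π → lookup t′ ≗ π′ → StrictlySurjective _≡_ π → ∀ p p′ χ χ′ →
    (proj₁ χ ∘ π ≗ proj₁ χ′ ∘ π′) ⇔ (proj₁ (σ g p χ) ∘ π ≗ proj₁ (σ g′ p′ χ′) ∘ π′)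
  transfer {G} {g} {π = π} {π′} t .t refl t≗π t≗π′ surj p p′ χ χ′ =
    ⇔-trans (≗-⇔ (λ _ → refl) (cong (proj₁ χ′) ∘ π′≗π))
      (⇔-trans (StrictInjection-∘-surjective G g R S surj (σ g p′ , proj₁ σ-ok g p′) χ χ′)
               (≗-⇔ (λ v → sym (proj₂ σ-ok g p p′ χ _)) (cong (proj₁ (σ g p′ χ′)) ∘ sym ∘ π′≗π)))
    where
    π′≗π : π′ ≗ π
    π′≗π v = trans (sym (t≗π′ v)) (t≗π v)

  member : ∀ G (p : Dr G) (ξ : Hom G R) → InG mod D R (𝓖 mod G R (proj₁ ξ))
  member G p ξ = G , proj₁ rep G p , ξ , refl

  ι : ∀ G (p : Dr G) (ξ : Hom G R) → SHom (𝓖 mod G R (proj₁ ξ)) R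
  ι G p ξ = ιq G R (proj₁ ξ) , ι-strict mod D R ind G (proj₁ rep G p) ξ

  σι : ∀ G (p : Dr G) (ξ : Hom G R) → SHom (𝓖 mod G R (proj₁ ξ)) S
  σι G p ξ = σ (𝓖 mod G R (proj₁ ξ)) (member G p ξ) (ι G p ξ)

  ρ : Scheme Dr R S
  ρ G p ξ@(f , _) = proj₁ (σι G p ξ) ∘ πq G R f , λ v w vw →
    proj₁ (proj₂ (σι G p ξ)) (πq G R f v) (πq G R f w) (πq-hom mod ext G R f v w vw)

  ρ-strong : IsStrongΓScheme Dr R S ρ
  ρ-strong G p = strongΓ-scheme G R S (ρ G p) ρ-Γ ρ-⇔
    where
    ρ-Γ : PreservesΓ G R S (ρ G p)
    ρ-Γ ξ = Γ-strict∘πq mod ext G R S (proj₁ ξ) (proj₂ (σι G p ξ))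
    ρ-⇔ : ∀ ξ ξ′ → SameΓ G R (proj₁ ξ) (proj₁ ξ′) → (proj₁ ξ ≗ proj₁ ξ′) ⇔ (proj₁ (ρ G p ξ) ≗ proj₁ (ρ G p ξ′))
    ρ-⇔ ξ@(f , _) ξ′@(f′ , _) same = ⇔-trans ι∘πq-⇔ (transfer {G} {𝓖 mod G R f} {𝓖 mod G R f′} {πq G R f} {πq G R f′}
      (tabulate (πq G R f)) (tabulate (πq G R f′)) (quotientData-Γ-determined mod G R {f} {f′} same)
      (lookup∘tabulate (πq G R f)) (lookup∘tabulate (πq G R f′)) (Fibres.πq-surjective G R f)
      (member G p ξ) (member G p ξ′) (ι G p ξ) (ι G p ξ′))
      where
      ι∘πq-⇔ : (f ≗ f′) ⇔ (ιq G R f ∘ πq G R f ≗ ιq G R f′ ∘ πq G R f′)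
      ι∘πq-⇔ = ≗-⇔ (sym ∘ Induced.induced∘πq G R f f (λ _ _ → refl))
                   (sym ∘ Induced.induced∘πq G R f′ f′ (λ _ _ → refl))

module Canonical (G R : Digraph) where

  Candidate : Set
  Candidate = Vec (V R) (suc (Digraph.m G))

  homAt : Candidate → V G → V G → Bool
  homAt t v w = does (T? (adjB G v w) →-dec T? (adjB R (lookup t v) (lookup t w)))

  homB : Candidate → Bool
  homB t = allF λ v → allF (homAt t v)

  homB-sound : ∀ t → T (homB t) → IsHom G R (lookup t)
  homB-sound t h v w = to (T-does (T? (adjB G v w) →-dec T? (adjB R (lookup t v) (lookup t w))))
    (allF⁻ (homAt t v) (allF⁻ (λ v → allF (homAt t v)) h v) w)

  sameΓAt : (V G → V R) → Candidate → V G → V G → Bool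
  sameΓAt f t v w = does (Γ G R (lookup t) v w B.≟ Γ G R f v w)

  sameΓB : (V G → V R) → Candidate → Bool
  sameΓB f t = allF λ v → allF (sameΓAt f t v)

  sameΓB-sound : ∀ f t → T (sameΓB f t) → SameΓ G R (lookup t) f
  sameΓB-sound f t s v w =
    to (T-does (Γ G R (lookup t) v w B.≟ _)) (allF⁻ (sameΓAt f t v) (allF⁻ (λ v → allF (sameΓAt f t v)) s v) w)

  admissible : (V G → V R) → Candidate → Bool
  admissible f t = homB t ∧ sameΓB f t

  tabulate-admissible : ((f , f-hom) : Hom G R) → T (admissible f (tabulate f))
  tabulate-admissible (f , f-hom) = from T-∧
    ( allF⁺ (λ v → allF (homAt t v)) (λ v → allF⁺ (homAt t v) (λ w →
        from (T-does (T? (adjB G v w) →-dec T? (adjB R (lookup t v) (lookup t w)))) λ vw →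
          subst₂ (Arc R) (sym (lookup∘tabulate f v)) (sym (lookup∘tabulate f w)) (f-hom v w vw)))
    , allF⁺ (λ v → allF (sameΓAt f t v)) (λ v → allF⁺ (sameΓAt f t v) (λ w →
        from (T-does (Γ G R (lookup t) v w B.≟ _)) (Γ-cong G R (lookup∘tabulate f) v w))))
    where t = tabulate f

  CanonicalHom : Set
  CanonicalHom = Σ Candidate (T ∘ homB)

  toHom : CanonicalHom → Hom G R
  toHom (t , t-hom) = lookup t , homB-sound t t-hom

  first-admissible : ((f , _) : Hom G R) → T (admissible f (firstV _ (admissible f)))
  first-admissible ξ@(f , _) =
    firstV-satisfies _ (admissible f) (anyV⁺ _ (admissible f) (tabulate f) (tabulate-admissible ξ))

  canonical : Hom G R → CanonicalHom
  canonical ξ@(f , _) = firstV _ (admissible f) , proj₁ (to (T-∧ {homB (firstV _ (admissible f))}) (first-admissible ξ))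

  canonical-sameΓ : (ξ : Hom G R) → SameΓ G R (proj₁ (toHom (canonical ξ))) (proj₁ ξ)
  canonical-sameΓ ξ@(f , _) =
    sameΓB-sound f (firstV _ (admissible f)) (proj₂ (to (T-∧ {homB (firstV _ (admissible f))}) (first-admissible ξ)))

  canonical-Γ-determined : ∀ ξ ξ′ → SameΓ G R (proj₁ ξ) (proj₁ ξ′) → canonical ξ ≡ canonical ξ′
  canonical-Γ-determined ξ ξ′ same = Σ-≡,≡→≡ (first≡ , T-irrelevant _ _)
    where
    first≡ : firstV _ (admissible (proj₁ ξ)) ≡ firstV _ (admissible (proj₁ ξ′))
    first≡ = firstV-cong _ (λ t → cong (homB t ∧_) (allF-cong λ v → allF-cong λ w →
               cong (λ b → does (Γ G R (lookup t) v w B.≟ b)) (same v w)))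

module FamilyScheme (mod : Modifier) (ext : Extensive mod) (D Dr : Digraph → Set) (R : Digraph)
                    (rep : RepSystem D Dr) (ind : InducedStrict mod R) (S : Digraph)
                    (families : InjFamilies mod D R S) where

  module _ (G : Digraph) (d : D G) where

    open Canonical G R

    base : CanonicalHom → V G → V R
    base c = proj₁ (toHom c)

    injectionAt : (c : CanonicalHom) → StrictInjection (𝓖 mod G R (base c)) R S
    injectionAt c = families (𝓖 mod G R (base c)) (G , d , toHom c , refl)

    inducedAt : (c : CanonicalHom) (ξ : Hom G R) → SameΓ G R (base c) (proj₁ ξ) → SHom (𝓖 mod G R (base c)) R
    inducedAt c (f , f-hom) same = induced G R (base c) f , ind G (base c) f same f-hom

    σχ : (c : CanonicalHom) (ξ : Hom G R) → SameΓ G R (base c) (proj₁ ξ) → SHom (𝓖 mod G R (base c)) S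
    σχ c ξ same = proj₁ (injectionAt c) (inducedAt c ξ same)

    schemeAt : (c : CanonicalHom) (ξ : Hom G R) → SameΓ G R (base c) (proj₁ ξ) → Hom G S
    schemeAt c ξ same = proj₁ (σχ c ξ same) ∘ πq G R (base c) , λ v w vw →
      proj₁ (proj₂ (σχ c ξ same)) (πq G R (base c) v) (πq G R (base c) w) (πq-hom mod ext G R (base c) v w vw)

    schemeAt-⇔ : ∀ {c c′} → c ≡ c′ → ∀ ξ ξ′ same same′ →
                 (proj₁ ξ ≗ proj₁ ξ′) ⇔ (proj₁ (schemeAt c ξ same) ≗ proj₁ (schemeAt c′ ξ′ same′))
    schemeAt-⇔ {c} refl ξ@(f , _) ξ′@(f′ , _) same same′ = ⇔-trans
      (≗-⇔ (sym ∘ Induced.induced∘πq G R (base c) f same) (sym ∘ Induced.induced∘πq G R (base c) f′ same′))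
      (StrictInjection-∘-surjective G (𝓖 mod G R (base c)) R S (Fibres.πq-surjective G R (base c)) (injectionAt c)
        (inducedAt c ξ same) (inducedAt c ξ′ same′))

    ρ : Hom G R → Hom G S
    ρ ξ = schemeAt (canonical ξ) ξ (canonical-sameΓ ξ)

    ρ-strong : IsStrongΓ G R S ρ
    ρ-strong = strongΓ-scheme G R S ρ ρ-Γ λ ξ ξ′ same →
      schemeAt-⇔ (canonical-Γ-determined ξ ξ′ same) ξ ξ′ (canonical-sameΓ ξ) (canonical-sameΓ ξ′)
      where
      ρ-Γ : PreservesΓ G R S ρ
      ρ-Γ ξ v w = trans
        (Γ-strict∘πq mod ext G R S (base (canonical ξ)) (proj₂ (σχ (canonical ξ) ξ (canonical-sameΓ ξ))) v w)
        (canonical-sameΓ ξ v w)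

  ⊑Γ : SqsubΓ Dr R S
  ⊑Γ = (λ G p → ρ G (proj₁ rep G p)) , (λ G p → ρ-strong G (proj₁ rep G p))

conclusion : ∀ (mod : Modifier) → Extensive mod → ∀ (D Dr : Digraph → Set) R (rep : RepSystem D Dr) →
             InducedStrict mod R → Closed mod D R → Conclusion mod D Dr R rep
conclusion mod ext D Dr R rep ind closed = ι-strict mod D R ind , λ S →
  (⊑Γ⇒InjFamilies mod D Dr R rep S closed , FamilyScheme.⊑Γ mod ext D Dr R rep ind S) ,
  λ σ σ-ok → let open FormulaScheme mod ext D Dr R rep ind S σ σ-ok in ρ , ρ-strong , λ _ _ _ _ → refl

proposition2 : (∀ (D Dr : Digraph → Set) (R : Digraph) (rep : RepSystem D Dr) →
                   D R → Closed idM D R → Conclusion idM D Dr R rep)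
             × (∀ (D Dr : Digraph → Set) (R : Digraph) (rep : RepSystem D Dr) →
                   (∀ G → D G → IsPoset G) →
                   D R → Closed tcM D R → Conclusion tcM D Dr R rep)
             × (∀ (D Dr : Digraph → Set) (R : Digraph) (rep : RepSystem D Dr) →
                   (∀ G → D G → InPStar G) →
                   D R → Closed tcM D R → Conclusion tcM D Dr R rep)
-- R ∈ 𝔇′ is used only to see that R is a poset (resp. in 𝔓*); the first part does not need it
proposition2 =
  (λ D Dr R rep _ → conclusion idM idM-extensive D Dr R rep (induced-strict-idM R)) ,
  (λ D Dr R rep posets R∈D → conclusion tcM tcM-extensive D Dr R rep (induced-strict-poset R (posets R R∈D))) ,
  (λ D Dr R rep stars R∈D → conclusion tcM tcM-extensive D Dr R rep (induced-strict-star R (stars R R∈D)))
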